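{- Let $\mathbf{A}$ be a dually integral po-semiring and $\boldsymbol{R}$ an $\mathbf{A}$-module. The following are equivalent: (1) $\boldsymbol{R}$ is cyclic and onto-projective in the category of $\mathbf{A}$-modules; (2) there is a retraction $f\colon\mathbf{A}\to\boldsymbol{R}$, i.e. a morphism $f$ for which there is a morphism $g\colon\boldsymbol{R}\to\mathbf{A}$ with $f\circ g=\mathrm{id}_{\boldsymbol{R}}$; (3) there are $\mu\in A$ and $v\in R$ such that $\mu\ast v=v$, $\{\sigma\ast v:\sigma\in A\}=R$, and for all $\sigma,\pi\in A$, if $\sigma\ast v\leq\pi\ast v$ then $\sigma\cdot\mu\leq\pi\cdot\mu$.
   Context: A po-semiring is $\mathbf{A}=\langle A,\leq,+,\cdot,0,1\rangle$ with $\langle A,\cdot,1\rangle$ a monoid, $\langle A,\leq,+,0\rangle$ a commutative monoid with compatible partial order, $\sigma\cdot0=0\cdot\sigma=0$, $\cdot$ distributing over $+$ on both sides, and $\sigma\leq\pi$, $0\leq\varepsilon$ imply $\sigma\varepsilon\leq\pi\varepsilon$ and $\varepsilon\sigma\leq\varepsilon\pi$; dually integral means $0$ is least. An $\mathbf{A}$-module is $\boldsymbol{R}=\langle R,\leq,+,0,\ast\rangle$ with $\langle R,\leq,+,0\rangle$ a commutative monoid with compatible partial order and least element $0$, and $\ast\colon A\times R\to R$ with $(\sigma\cdot\pi)\ast a=\sigma\ast(\pi\ast a)$, $1\ast a=a$, $0\ast a=0$, $\sigma\ast(a+b)=\sigma\ast a+\sigma\ast b$, $(\sigma+\pi)\ast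 a=\sigma\ast a+\pi\ast a$, and $\ast$ order-preserving in each coordinate. $\mathbf{A}$ itself is regarded as an $\mathbf{A}$-module $\langle A,\leq,+,0,\cdot\rangle$. Morphisms are order-preserving monoid homomorphisms $\tau$ with $\tau(\sigma\ast a)=\sigma\ast\tau(a)$. $\boldsymbol{R}$ is cyclic if $R=\{\sigma\ast a:\sigma\in A\}$ for some $a\in R$; it is onto-projective if for all morphisms $f\colon\boldsymbol{S}\to\boldsymbol{T}$ surjective and $g\colon\boldsymbol{R}\to\boldsymbol{T}$ there is a morphism $h\colon\boldsymbol{R}\to\boldsymbol{S}$ with $f\circ h=g$. -}

module Defs where

open import Level using (Level; suc; _⊔_)
open import Data.Product using (Σ; ∃; _×_; _,_)
open import Relation.Binary.PropositionalEquality using (_≡_)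
open import Relation.Binary.Structures using (IsPartialOrder)
open import Algebra.Structures using (IsMonoid; IsCommutativeMonoid)

record PoSemiring (ℓ : Level) : Set (suc ℓ) where
  infixl 7 _·_
  infixl 6 _+_
  infix 4 _≤_
  field
    Carrier : Set ℓ
    _≤_ : Carrier → Carrier → Set ℓ
    _+_ : Carrier → Carrier → Carrier
    _·_ : Carrier → Carrier → Carrier
    0# : Carrier
    1# : Carrier
    ·-isMonoid : IsMonoid _≡_ _·_ 1#
    +-isCommutativeMonoid : IsCommutativeMonoid _≡_ _+_ 0#
    ≤-isPartialOrder : IsPartialOrder _≡_ _≤_
    +-mono-≤ : ∀ {x y} z → x ≤ y → x + z ≤ y + z
    zeroˡ : ∀ x → 0# · x ≡ 0#
    zeroʳ : ∀ x → x · 0# ≡ 0#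
    distribˡ : ∀ x y z → x · (y + z) ≡ x · y + x · z
    distribʳ : ∀ x y z → (y + z) · x ≡ y · x + z · x
    ·-monoˡ-≤ : ∀ {σ π ε} → σ ≤ π → 0# ≤ ε → σ · ε ≤ π · ε
    ·-monoʳ-≤ : ∀ {σ π ε} → σ ≤ π → 0# ≤ ε → ε · σ ≤ ε · π

DuallyIntegral : ∀ {ℓ} → PoSemiring ℓ → Set ℓ
DuallyIntegral A = ∀ x → 0# ≤ x
  where open PoSemiring A

record Module {ℓ : Level} (A : PoSemiring ℓ) : Set (suc ℓ) where
  private module A = PoSemiring A
  infixr 8 _∗_
  infixl 6 _+_
  infix 4 _≤_
  field
    Carrier : Set ℓ
    _≤_ : Carrier → Carrier → Set ℓ
    _+_ : Carrier → Carrier → Carrier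
    0# : Carrier
    _∗_ : A.Carrier → Carrier → Carrier
    +-isCommutativeMonoid : IsCommutativeMonoid _≡_ _+_ 0#
    ≤-isPartialOrder : IsPartialOrder _≡_ _≤_
    +-mono-≤ : ∀ {a b} c → a ≤ b → a + c ≤ b + c
    0-least : ∀ a → 0# ≤ a
    ∗-assoc : ∀ σ π a → (σ A.· π) ∗ a ≡ σ ∗ (π ∗ a)
    ∗-identity : ∀ a → A.1# ∗ a ≡ a
    ∗-zero : ∀ a → A.0# ∗ a ≡ 0#
    ∗-distribˡ : ∀ σ a b → σ ∗ (a + b) ≡ σ ∗ a + σ ∗ b
    ∗-distribʳ : ∀ σ π a → (σ A.+ π) ∗ a ≡ σ ∗ a + π ∗ a
    ∗-monoˡ-≤ : ∀ {σ π} a → σ A.≤ π → σ ∗ a ≤ π ∗ a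
    ∗-monoʳ-≤ : ∀ σ {a b} → a ≤ b → σ ∗ a ≤ σ ∗ b

-- A regarded as an A-module ⟨A, ≤, +, 0, ·⟩ (needs A dually integral,
-- since modules require 0 to be least).
selfModule : ∀ {ℓ} (A : PoSemiring ℓ) → DuallyIntegral A → Module A
selfModule A di = record
  { Carrier = Carrier
  ; _≤_ = _≤_
  ; _+_ = _+_
  ; 0# = 0#
  ; _∗_ = _·_
  ; +-isCommutativeMonoid = +-isCommutativeMonoid
  ; ≤-isPartialOrder = ≤-isPartialOrder
  ; +-mono-≤ = +-mono-≤
  ; 0-least = di
  ; ∗-assoc = IsMonoid.assoc ·-isMonoid
  ; ∗-identity = IsMonoid.identityˡ ·-isMonoid
  ; ∗-zero = zeroˡ
  ; ∗-distribˡ = distribˡ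
  ; ∗-distribʳ = λ σ π a → distribʳ a σ π
  ; ∗-monoˡ-≤ = λ a σ≤π → ·-monoˡ-≤ σ≤π (di a)
  ; ∗-monoʳ-≤ = λ σ a≤b → ·-monoʳ-≤ a≤b (di σ)
  }
  where open PoSemiring A

record Morphism {ℓ} {A : PoSemiring ℓ} (M N : Module A) : Set ℓ where
  private
    module M = Module M
    module N = Module N
  field
    fun : M.Carrier → N.Carrier
    mono : ∀ {a b} → a M.≤ b → fun a N.≤ fun b
    pres-0 : fun M.0# ≡ N.0#
    pres-+ : ∀ a b → fun (a M.+ b) ≡ fun a N.+ fun b
    pres-∗ : ∀ σ a → fun (σ M.∗ a) ≡ σ N.∗ fun a

open Morphism public

Surjective : ∀ {ℓ} {A : PoSemiring ℓ} {M N : Module A} → Morphism M N → Set ℓ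
Surjective {N = N} f = ∀ (t : Module.Carrier N) → ∃ λ s → fun f s ≡ t

Cyclic : ∀ {ℓ} {A : PoSemiring ℓ} → Module A → Set ℓ
Cyclic {A = A} R =
  ∃ λ (a : Module.Carrier R) → ∀ (r : Module.Carrier R) →
    ∃ λ (σ : PoSemiring.Carrier A) → Module._∗_ R σ a ≡ r

OntoProjective : ∀ {ℓ} {A : PoSemiring ℓ} → Module A → Set (suc ℓ)
OntoProjective {A = A} R =
  ∀ (S T : Module A) (f : Morphism S T) → Surjective f →
  ∀ (g : Morphism R T) →
    ∃ λ (h : Morphism R S) → ∀ r → fun f (fun h r) ≡ fun g r

IsRetraction : ∀ {ℓ} {A : PoSemiring ℓ} (di : DuallyIntegral A) {R : Module A} →
               Morphism (selfModule A di) R → Set ℓ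
IsRetraction {A = A} di {R} f =
  ∃ λ (g : Morphism R (selfModule A di)) → ∀ r → fun f (fun g r) ≡ r

Condition3 : ∀ {ℓ} {A : PoSemiring ℓ} → Module A → Set ℓ
Condition3 {A = A} R =
  ∃ λ (μ : A.Carrier) → ∃ λ (v : R.Carrier) →
    (μ R.∗ v ≡ v) ×
    (∀ (r : R.Carrier) → ∃ λ σ → σ R.∗ v ≡ r) ×
    (∀ σ π → σ R.∗ v R.≤ π R.∗ v → σ A.· μ A.≤ π A.· μ)
  where
    module A = PoSemiring A
    module R = Module R

-- A is the free module on one generator 1, so it is onto-projective, and the morphisms A → M are
-- exactly the maps σ ↦ σ ∗ m. Projectivity and cyclicity pass to retracts, and conversely a cyclic
-- onto-projective R splits the surjection σ ↦ σ ∗ a. A section g of f : A → R is determined by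
-- μ = g (f 1), since g (σ ∗ f 1) = σ · μ; condition (3) says precisely that σ ∗ v ↦ σ · μ is a
-- well-defined, monotone morphism, which is then a section of σ ↦ σ ∗ v.
module Submission where

open import Defs
open import Level using (Level)
open import Data.Product using (∃; _×_; _,_; proj₁; proj₂)
open import Function.Bundles using (_⇔_; mk⇔)
open import Relation.Binary.PropositionalEquality
open import Relation.Binary.Structures using (IsPartialOrder)
open import Algebra.Structures using (IsMonoid)

module _ {ℓ : Level} {A : PoSemiring ℓ} where
  private module A = PoSemiring A

  infixr 9 _∘ᴹ_

  idᴹ : {M : Module A} → Morphism M M
  idᴹ = record
    { fun = λ x → x ; mono = λ le → le ; pres-0 = refl
    ; pres-+ = λ _ _ → refl ; pres-∗ = λ _ _ → refl }

  _∘ᴹ_ : {M N P : Module A} → Morphism N P → Morphism M N → Morphism M P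
  p ∘ᴹ q = record
    { fun = λ x → fun p (fun q x)
    ; mono = λ le → mono p (mono q le)
    ; pres-0 = trans (cong (fun p) (pres-0 q)) (pres-0 p)
    ; pres-+ = λ a b → trans (cong (fun p) (pres-+ q a b)) (pres-+ p _ _)
    ; pres-∗ = λ σ a → trans (cong (fun p) (pres-∗ q σ a)) (pres-∗ p _ _) }

  retraction⇒surjective : {M N : Module A} (f : Morphism M N) (g : Morphism N M) →
                          (∀ n → fun f (fun g n) ≡ n) → Surjective f
  retraction⇒surjective f g fg n = fun g n , fg n

  surjective-cyclic : {M N : Module A} (f : Morphism M N) → Surjective f → Cyclic M → Cyclic N
  surjective-cyclic {M} {N} f surj (a , gen) = fun f a , λ n →
    let (m , fm≡n) = surj n ; (σ , σa≡m) = gen m in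
    σ , (begin
      σ N.∗ fun f a   ≡⟨ pres-∗ f σ a ⟨
      fun f (σ M.∗ a) ≡⟨ cong (fun f) σa≡m ⟩
      fun f m         ≡⟨ fm≡n ⟩
      n               ∎)
    where
    open ≡-Reasoning
    module M = Module M
    module N = Module N

  retract-ontoProjective : {P R : Module A} (f : Morphism P R) (g : Morphism R P) →
                           (∀ r → fun f (fun g r) ≡ r) → OntoProjective P → OntoProjective R
  retract-ontoProjective f g fg projP S T p surj q =
    let (h , ph≡qf) = projP S T p surj (q ∘ᴹ f) in
    h ∘ᴹ g , λ r → trans (ph≡qf (fun g r)) (cong (fun q) (fg r))

module _ {ℓ : Level} (A : PoSemiring ℓ) (di : DuallyIntegral A) where
  private
    module A = PoSemiring A
    Aₘ : Module A
    Aₘ = selfModule A di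

  act : (M : Module A) → Module.Carrier M → Morphism Aₘ M
  act M m = record
    { fun = λ σ → σ M.∗ m
    ; mono = M.∗-monoˡ-≤ m
    ; pres-0 = M.∗-zero m
    ; pres-+ = λ σ π → M.∗-distribʳ σ π m
    ; pres-∗ = λ σ π → M.∗-assoc σ π m }
    where module M = Module M

  fun≡act : (M : Module A) (f : Morphism Aₘ M) → ∀ σ → fun f σ ≡ Module._∗_ M σ (fun f A.1#)
  fun≡act M f σ = trans (cong (fun f) (sym (IsMonoid.identityʳ A.·-isMonoid σ))) (pres-∗ f σ A.1#)

  selfModule-cyclic : Cyclic Aₘ
  selfModule-cyclic = A.1# , λ σ → σ , IsMonoid.identityʳ A.·-isMonoid σ

  selfModule-ontoProjective : OntoProjective Aₘ
  selfModule-ontoProjective S T p surj q =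
    let (s , ps≡q1) = surj (fun q A.1#) in
    act S s , λ σ → begin
      fun p (σ S.∗ s)  ≡⟨ pres-∗ p σ s ⟩
      σ T.∗ fun p s    ≡⟨ cong (σ T.∗_) ps≡q1 ⟩
      σ T.∗ fun q A.1# ≡⟨ fun≡act T q σ ⟨
      fun q σ          ∎
    where
    open ≡-Reasoning
    module S = Module S
    module T = Module T

  module _ (R : Module A) where
    private module R = Module R

    RetractOfA : Set ℓ
    RetractOfA = ∃ λ (f : Morphism Aₘ R) → IsRetraction di f

    cyclic-ontoProjective⇒retractOfA : Cyclic R → OntoProjective R → RetractOfA
    cyclic-ontoProjective⇒retractOfA (a , gen) projR =
      act R a , projR Aₘ R (act R a) gen idᴹ

    retractOfA⇒cyclic-ontoProjective : RetractOfA → Cyclic R × OntoProjective R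
    retractOfA⇒cyclic-ontoProjective (f , g , fg) =
      surjective-cyclic f (retraction⇒surjective f g fg) selfModule-cyclic ,
      retract-ontoProjective f g fg selfModule-ontoProjective

    retractOfA⇒condition3 : RetractOfA → Condition3 R
    retractOfA⇒condition3 (f , g , fg) = μ , v , μv≡v , generates , reflects
      where
      v = fun f A.1#
      μ = fun g v
      generates : ∀ r → ∃ λ σ → σ R.∗ v ≡ r
      generates r = fun g r , trans (sym (fun≡act R f (fun g r))) (fg r)
      μv≡v : μ R.∗ v ≡ v
      μv≡v = proj₂ (generates v)
      reflects : ∀ σ π → σ R.∗ v R.≤ π R.∗ v → σ A.· μ A.≤ π A.· μ
      reflects σ π le = subst₂ A._≤_ (pres-∗ g σ v) (pres-∗ g π v) (mono g le)

    condition3⇒retractOfA : Condition3 R → RetractOfA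
    condition3⇒retractOfA (μ , v , μv≡v , generates , reflects) = act R v , g , fg
      where
      coeff : R.Carrier → A.Carrier
      coeff r = proj₁ (generates r)
      coeff∗v : ∀ r → coeff r R.∗ v ≡ r
      coeff∗v r = proj₂ (generates r)

      ·μ-welldefined : ∀ σ π → σ R.∗ v ≡ π R.∗ v → σ A.· μ ≡ π A.· μ
      ·μ-welldefined σ π e = IsPartialOrder.antisym A.≤-isPartialOrder
        (reflects σ π (IsPartialOrder.reflexive R.≤-isPartialOrder e))
        (reflects π σ (IsPartialOrder.reflexive R.≤-isPartialOrder (sym e)))

      coeff-welldefined : ∀ σ r → σ R.∗ v ≡ r → coeff r A.· μ ≡ σ A.· μ
      coeff-welldefined σ r σv≡r = ·μ-welldefined (coeff r) σ (trans (coeff∗v r) (sym σv≡r))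

      g : Morphism R Aₘ
      g = record
        { fun = λ r → coeff r A.· μ
        ; mono = λ {a} {b} le →
            reflects (coeff a) (coeff b) (subst₂ R._≤_ (sym (coeff∗v a)) (sym (coeff∗v b)) le)
        ; pres-0 = trans (coeff-welldefined A.0# R.0# (R.∗-zero v)) (A.zeroˡ μ)
        ; pres-+ = λ a b →
            trans (coeff-welldefined (coeff a A.+ coeff b) (a R.+ b)
                    (trans (R.∗-distribʳ (coeff a) (coeff b) v)
                           (cong₂ R._+_ (coeff∗v a) (coeff∗v b))))
                  (A.distribʳ μ (coeff a) (coeff b))
        ; pres-∗ = λ σ a →
            trans (coeff-welldefined (σ A.· coeff a) (σ R.∗ a)
                    (trans (R.∗-assoc σ (coeff a) v) (cong (σ R.∗_) (coeff∗v a))))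
                  (IsMonoid.assoc A.·-isMonoid σ (coeff a) μ) }

      fg : ∀ r → (coeff r A.· μ) R.∗ v ≡ r
      fg r = begin
        (coeff r A.· μ) R.∗ v ≡⟨ R.∗-assoc (coeff r) μ v ⟩
        coeff r R.∗ (μ R.∗ v) ≡⟨ cong (coeff r R.∗_) μv≡v ⟩
        coeff r R.∗ v         ≡⟨ coeff∗v r ⟩
        r                     ∎
        where open ≡-Reasoning

theorem4p17 : ∀ {ℓ : Level} (A : PoSemiring ℓ) (di : DuallyIntegral A) (R : Module A) →
    ((Cyclic R × OntoProjective R) ⇔ (∃ λ (f : Morphism (selfModule A di) R) → IsRetraction di f))
    × ((∃ λ (f : Morphism (selfModule A di) R) → IsRetraction di f) ⇔ Condition3 R)
theorem4p17 A di R =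
  mk⇔ (λ (cyc , proj) → cyclic-ontoProjective⇒retractOfA A di R cyc proj)
      (retractOfA⇒cyclic-ontoProjective A di R) ,
  mk⇔ (retractOfA⇒condition3 A di R) (condition3⇒retractOfA A di R)
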